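{- Let $G$ be a graph without isolated vertices. For every matching $M$ of clauses of $\psi(G)$ and every set $\mathbf{S}$ of satisfying assignments of $\psi(G)$ that fixes $M$, we have $Pr(\mathbf{S}) \leq (7/8)^{|M|}$, where $Pr$ is the probability in the Vertex-Edge probability space $\mathcal{VE}(G)$.
   Context: $\psi(G)$ is the CNF with variable set $V(G)\cup E(G)$ and, for each edge $e=\{u,v\}$, the clause $(u\vee e\vee v)$, viewed as the set of literals $\{u,e,v\}$. An assignment is a set of literals with no variable together with its negation; $\mathbf{SAT}(G)$ is the set of satisfying assignments of $\psi(G)$ with variable set exactly $V(G)\cup E(G)$. The space $\mathcal{VE}(G)$ has universe $\mathbf{SAT}(G)$; for $S\in\mathbf{SAT}(G)$, an edge $\{u,v\}$ is free for $S$ if $u$ or $v$ occurs positively in $S$, $Free(S)$ is the set of free edges, and $Pr(S)=2^{ -(|V(G)|+|Free(S)|)}$; the probability of a set is the sum of the probabilities of its elements. A set $\mathbf{S}\subseteq\mathbf{SAT}(G)$ fixes a clause $C$ if there is a proper subset $C'\subset C$ such that $S\cap C'\neq\emptyset$ for every $S\in\mathbf{S}$; it fixes a set of clauses if it fixes each of them. A matching of clauses is a set of clauses of $\psi(G)$ whose corresponding edges form a matching of $G$. -}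

module Defs where

open import Data.Nat using (ℕ; zero; suc; _+_)
open import Data.Bool using (Bool; true; false; _∨_; _∧_; T)
open import Data.Fin using (Fin)
open import Data.Vec using (Vec; lookup)
open import Data.Product using (_×_; _,_; proj₁; proj₂; ∃-syntax)
open import Data.Sum using (_⊎_)
open import Data.List using (List; []; _∷_; length; filter)
open import Data.List.Membership.Propositional using (_∈_)
open import Data.Empty using (⊥)
open import Relation.Nullary using (¬_)
open import Relation.Binary.PropositionalEquality using (_≡_; _≢_)
open import Data.Integer using (+_)
import Data.Rational as ℚ
open ℚ using (ℚ; ½; 1ℚ; 0ℚ)

record Graph : Set where
  field
    n    : ℕ
    m    : ℕ
    end₁ : Fin m → Fin n
    end₂ : Fin m → Fin n
    loopless : ∀ e → end₁ e ≢ end₂ e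
    simple   : ∀ e e' → end₁ e ≡ end₁ e' × end₂ e ≡ end₂ e'
                      ⊎ end₁ e ≡ end₂ e' × end₂ e ≡ end₁ e' → e ≡ e'
open Graph public

Incident : (G : Graph) → Fin (n G) → Fin (m G) → Set
Incident G v e = v ≡ end₁ G e ⊎ v ≡ end₂ G e

NoIsolatedVertices : Graph → Set
NoIsolatedVertices G = ∀ v → ∃[ e ] Incident G v e

-- Assignments of psi(G) with variable set exactly V(G) ∪ E(G).
-- A total assignment is given by the truth value of each variable:
-- the variable x occurs positively in S iff its value is true,
-- negatively iff it is false.

Assignment : Graph → Set
Assignment G = Vec Bool (n G) × Vec Bool (m G)

vval : (G : Graph) → Assignment G → Fin (n G) → Bool
vval G S v = lookup (proj₁ S) v

eval : (G : Graph) → Assignment G → Fin (m G) → Bool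
eval G S e = lookup (proj₂ S) e

SatClause : (G : Graph) → Assignment G → Fin (m G) → Set
SatClause G S e = T (vval G S (end₁ G e) ∨ eval G S e ∨ vval G S (end₂ G e))

Satisfies : (G : Graph) → Assignment G → Set
Satisfies G S = ∀ e → SatClause G S e

isFree : (G : Graph) → Assignment G → Fin (m G) → Bool
isFree G S e = vval G S (end₁ G e) ∨ vval G S (end₂ G e)

allFinList : (k : ℕ) → List (Fin k)
allFinList k = Data.List.tabulate {n = k} (λ i → i)
  where import Data.List

numFree : (G : Graph) → Assignment G → ℕ
numFree G S = length (filter (λ e → Data.Bool.Properties.T? (isFree G S e)) (allFinList (m G)))
  where import Data.Bool.Properties

_^ℚ_ : ℚ → ℕ → ℚ
q ^ℚ zero  = 1ℚ
q ^ℚ suc k = q ℚ.* (q ^ℚ k)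

PrAssignment : (G : Graph) → Assignment G → ℚ
PrAssignment G S = ½ ^ℚ (n G + numFree G S)

-- Probability of a (finite) set of assignments, given as a
-- duplicate-free list: the sum of the probabilities of its elements.
Pr : (G : Graph) → List (Assignment G) → ℚ
Pr G []       = 0ℚ
Pr G (S ∷ 𝐒) = PrAssignment G S ℚ.+ Pr G 𝐒

-- The clause of e is the literal set {u, e, v} (u = end₁ e,
-- v = end₂ e, three distinct variables, all positive).  A subset C' of
-- it is described by three booleans (u ∈ C', e ∈ C', v ∈ C'); it is a
-- proper subset iff not all three are true.  S ∩ C' ≠ ∅ iff some
-- literal of C' occurs in S, i.e. is assigned true.

MeetsSub : (G : Graph) → Fin (m G) → Bool × Bool × Bool → Assignment G → Set
MeetsSub G e (bu , be , bv) S =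
  T ((bu ∧ vval G S (end₁ G e)) ∨ (be ∧ eval G S e) ∨ (bv ∧ vval G S (end₂ G e)))

ProperSub : Bool × Bool × Bool → Set
ProperSub (bu , be , bv) = ¬ T (bu ∧ be ∧ bv)

FixesClause : (G : Graph) → List (Assignment G) → Fin (m G) → Set
FixesClause G 𝐒 e =
  ∃[ C' ] (ProperSub C' × (∀ S → S ∈ 𝐒 → MeetsSub G e C' S))

-- a set of clauses, identified by their edges
FixesAll : (G : Graph) → List (Assignment G) → List (Fin (m G)) → Set
FixesAll G 𝐒 M = ∀ e → e ∈ M → FixesClause G 𝐒 e

IsMatching : (G : Graph) → List (Fin (m G)) → Set
IsMatching G M = ∀ e e' → e ∈ M → e' ∈ M → e ≢ e' →
  ∀ v → Incident G v e → Incident G v e' → ⊥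

-- Draw an assignment by tossing a fair coin for every vertex and every edge and then forcing
-- every non-free edge to true. A satisfying assignment S is drawn with probability exactly
-- Pr(S), so Pr(𝐒) is the probability that the drawn assignment lies in 𝐒, which is at most the
-- probability that it meets the fixing subclause of every clause of M. Flipping the two vertex
-- coins and the edge coin of one edge of M preserves the uniform distribution and, M being a
-- matching, does not change what happens at the other edges of M. Hence the event at that edge
-- is independent of the others, and it has probability at most 7/8 because a proper subclause
-- is missed by one of the 8 local configurations.
module Submission where

open import Defs
open import Function using (_∘_)
open import Function.Bundles using (Equivalence)
open import Data.Nat using (ℕ; zero; suc) renaming (_+_ to _+ℕ_)
open import Data.Bool using (Bool; true; false; _∧_; _∨_; _xor_; T; if_then_else_)
open import Data.Bool.Properties using (T-∧)
import Data.Bool as Bool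
open import Data.Fin using (Fin; zero; suc)
open import Data.Vec using (Vec; []; _∷_; lookup; tabulate; updateAt; zipWith)
open import Data.Vec.Properties using (lookup∘updateAt; lookup∘updateAt′; lookup∘tabulate)
import Data.Vec.Properties as Vec
open import Data.Product using (_×_; _,_; proj₁; proj₂; uncurry)
open import Data.Product.Properties using (,-injective)
open import Data.Sum using (inj₁; inj₂)
open import Data.Unit using (tt)
open import Data.Empty using (⊥)
open import Data.List using (List; []; _∷_; length; filter)
import Data.List as List
open import Data.List.Membership.Propositional using (_∈_; _∉_)
open import Data.List.Relation.Unary.Any using (here; there)
open import Data.List.Relation.Unary.All using (All; []; _∷_)
import Data.List.Relation.Unary.All as All
open import Data.List.Relation.Unary.AllPairs using (AllPairs; []; _∷_)
open import Data.List.Relation.Unary.Unique.Propositional using (Unique)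
open import Data.Integer using (+_)
open import Data.Rational using (ℚ; ½; 0ℚ; 1ℚ; _+_; _*_; _≤_; _/_; nonNegative)
open import Data.Rational.Properties
  using (≤-reflexive; ≤ᵇ⇒≤; +-comm; +-identityˡ; +-mono-≤; *-comm; *-assoc; *-identityˡ; *-zeroˡ;
         *-monoˡ-≤-nonNeg; *-monoʳ-≤-nonNeg; module ≤-Reasoning)
open import Data.Rational.Solver using (module +-*-Solver)
open import Relation.Nullary using (yes; no; does; contradiction)
open import Relation.Nullary.Decidable using (map′; _×-dec_)
open import Relation.Binary.Definitions using (DecidableEquality)
open import Relation.Binary.PropositionalEquality
  using (_≡_; _≢_; refl; sym; trans; cong; cong₂; subst; module ≡-Reasoning)

open +-*-Solver

𝟙 : Bool → ℚ
𝟙 true  = 1ℚ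
𝟙 false = 0ℚ

𝟙-∧ : ∀ p q → 𝟙 (p ∧ q) ≡ 𝟙 p * 𝟙 q
𝟙-∧ true  q = sym (*-identityˡ (𝟙 q))
𝟙-∧ false q = sym (*-zeroˡ (𝟙 q))

𝟙-nonNeg : ∀ p → 0ℚ ≤ 𝟙 p
𝟙-nonNeg true  = ≤ᵇ⇒≤ tt
𝟙-nonNeg false = ≤ᵇ⇒≤ tt

^ℚ-distribˡ-+-* : ∀ q a b → q ^ℚ (a +ℕ b) ≡ q ^ℚ a * q ^ℚ b
^ℚ-distribˡ-+-* q zero    b = sym (*-identityˡ (q ^ℚ b))
^ℚ-distribˡ-+-* q (suc a) b = trans (cong (q *_) (^ℚ-distribˡ-+-* q a b)) (sym (*-assoc q _ _))

∏ : ∀ N → (Fin N → ℚ) → ℚ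
∏ zero    f = 1ℚ
∏ (suc N) f = f zero * ∏ N (f ∘ suc)

∏-cong : ∀ N {f g : Fin N → ℚ} → (∀ j → f j ≡ g j) → ∏ N f ≡ ∏ N g
∏-cong zero    f≗g = refl
∏-cong (suc N) f≗g = cong₂ _*_ (f≗g zero) (∏-cong N (f≗g ∘ suc))

½^length-filter : ∀ {A : Set} N (f : Fin N → A) (P : A → Bool) →
  ½ ^ℚ length (filter (Bool.T? ∘ P) (List.tabulate f)) ≡ ∏ N (λ j → if P (f j) then ½ else 1ℚ)
½^length-filter zero    f P = refl
½^length-filter (suc N) f P with P (f zero)
... | true  = cong (½ *_) (½^length-filter N (f ∘ suc) P)
... | false = trans (½^length-filter N (f ∘ suc) P) (sym (*-identityˡ _))

avg : (Bool → ℚ) → ℚ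
avg f = ½ * (f true + f false)

avg-mono : ∀ {f g} → (∀ c → f c ≤ g c) → avg f ≤ avg g
avg-mono f≤g = *-monoˡ-≤-nonNeg ½ (+-mono-≤ (f≤g true) (f≤g false))

avg-+ : ∀ f g → avg (λ c → f c + g c) ≡ avg f + avg g
avg-+ f g =
  solve 4 (λ a b c d → con ½ :* ((a :+ b) :+ (c :+ d)) := con ½ :* (a :+ c) :+ con ½ :* (b :+ d))
        refl (f true) (g true) (f false) (g false)

avg-*ˡ : ∀ k f → avg (λ c → k * f c) ≡ k * avg f
avg-*ˡ k f = solve 3 (λ k a b → con ½ :* (k :* a :+ k :* b) := k :* (con ½ :* (a :+ b)))
                    refl k (f true) (f false)

avg-*ʳ : ∀ f k → avg (λ c → f c * k) ≡ avg f * k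
avg-*ʳ f k = solve 3 (λ k a b → con ½ :* (a :* k :+ b :* k) := con ½ :* (a :+ b) :* k)
                    refl k (f true) (f false)

avg-const : ∀ q → avg (λ _ → q) ≡ q
avg-const = solve 1 (λ q → con ½ :* (q :+ q) := q) refl

avg-xorˡ : ∀ a f → avg (λ c → f (a xor c)) ≡ avg f
avg-xorˡ true  f = cong (½ *_) (+-comm (f false) (f true))
avg-xorˡ false f = refl

avg-xorʳ : ∀ a f → avg (λ c → f (c xor a)) ≡ avg f
avg-xorʳ true  f = cong (½ *_) (+-comm (f false) (f true))
avg-xorʳ false f = refl

𝔼 : ∀ N → (Vec Bool N → ℚ) → ℚ
𝔼 zero    f = f []
𝔼 (suc N) f = avg (λ c → 𝔼 N (λ v → f (c ∷ v)))

𝔼-cong : ∀ N {f g : Vec Bool N → ℚ} → (∀ v → f v ≡ g v) → 𝔼 N f ≡ 𝔼 N g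
𝔼-cong zero    f≗g = f≗g []
𝔼-cong (suc N) f≗g =
  cong₂ (λ a b → ½ * (a + b)) (𝔼-cong N (f≗g ∘ (true ∷_))) (𝔼-cong N (f≗g ∘ (false ∷_)))

𝔼-mono : ∀ N {f g : Vec Bool N → ℚ} → (∀ v → f v ≤ g v) → 𝔼 N f ≤ 𝔼 N g
𝔼-mono zero    f≤g = f≤g []
𝔼-mono (suc N) f≤g = avg-mono (λ c → 𝔼-mono N (f≤g ∘ (c ∷_)))

𝔼-+ : ∀ N f g → 𝔼 N (λ v → f v + g v) ≡ 𝔼 N f + 𝔼 N g
𝔼-+ zero    f g = refl
𝔼-+ (suc N) f g = begin
  avg (λ c → 𝔼 N (λ v → f (c ∷ v) + g (c ∷ v)))
    ≡⟨ cong₂ (λ a b → ½ * (a + b)) (𝔼-+ N _ _) (𝔼-+ N _ _) ⟩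
  avg (λ c → 𝔼 N (f ∘ (c ∷_)) + 𝔼 N (g ∘ (c ∷_)))
    ≡⟨ avg-+ (λ c → 𝔼 N (f ∘ (c ∷_))) (λ c → 𝔼 N (g ∘ (c ∷_))) ⟩
  𝔼 (suc N) f + 𝔼 (suc N) g ∎
  where open ≡-Reasoning

𝔼-*ˡ : ∀ N k f → 𝔼 N (λ v → k * f v) ≡ k * 𝔼 N f
𝔼-*ˡ zero    k f = refl
𝔼-*ˡ (suc N) k f =
  trans (cong₂ (λ a b → ½ * (a + b)) (𝔼-*ˡ N k _) (𝔼-*ˡ N k _)) (avg-*ˡ k (λ c → 𝔼 N (f ∘ (c ∷_))))

𝔼-*ʳ : ∀ N f k → 𝔼 N (λ v → f v * k) ≡ 𝔼 N f * k
𝔼-*ʳ N f k = trans (𝔼-cong N (λ v → *-comm (f v) k)) (trans (𝔼-*ˡ N k f) (*-comm k (𝔼 N f)))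

𝔼-const : ∀ N q → 𝔼 N (λ _ → q) ≡ q
𝔼-const zero    q = refl
𝔼-const (suc N) q = trans (cong (λ a → ½ * (a + a)) (𝔼-const N q)) (avg-const q)

𝔼-nonNeg : ∀ N {f} → (∀ v → 0ℚ ≤ f v) → 0ℚ ≤ 𝔼 N f
𝔼-nonNeg N {f} f≥0 = subst (_≤ 𝔼 N f) (𝔼-const N 0ℚ) (𝔼-mono N f≥0)

𝔼-avg : ∀ N (f : Bool → Vec Bool N → ℚ) → 𝔼 N (λ v → avg (λ c → f c v)) ≡ avg (λ c → 𝔼 N (f c))
𝔼-avg N f = trans (𝔼-*ˡ N ½ _) (cong (½ *_) (𝔼-+ N (f true) (f false)))

𝔼-comm : ∀ N K (f : Vec Bool N → Vec Bool K → ℚ) →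
  𝔼 N (λ x → 𝔼 K (f x)) ≡ 𝔼 K (λ y → 𝔼 N (λ x → f x y))
𝔼-comm zero    K f = refl
𝔼-comm (suc N) K f =
  trans (cong₂ (λ a b → ½ * (a + b)) (𝔼-comm N K _) (𝔼-comm N K _))
        (sym (𝔼-avg K (λ c y → 𝔼 N (λ x → f (c ∷ x) y))))

_⊕_ : ∀ {N} → Vec Bool N → Vec Bool N → Vec Bool N
_⊕_ = zipWith _xor_

𝔼-⊕ : ∀ N (a : Vec Bool N) f → 𝔼 N (λ v → f (v ⊕ a)) ≡ 𝔼 N f
𝔼-⊕ zero    []       f = refl
𝔼-⊕ (suc N) (a ∷ as) f =
  trans (cong₂ (λ p q → ½ * (p + q)) (𝔼-⊕ N as _) (𝔼-⊕ N as _))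
        (avg-xorʳ a (λ c → 𝔼 N (f ∘ (c ∷_))))

flipAt : ∀ {N} → Fin N → Bool → Vec Bool N → Vec Bool N
flipAt k t v = updateAt v k (t xor_)

𝔼-flipAt : ∀ N k t f → 𝔼 N (λ v → f (flipAt k t v)) ≡ 𝔼 N f
𝔼-flipAt (suc N) zero    t f = avg-xorˡ t (λ c → 𝔼 N (f ∘ (c ∷_)))
𝔼-flipAt (suc N) (suc k) t f =
  cong₂ (λ a b → ½ * (a + b)) (𝔼-flipAt N k t _) (𝔼-flipAt N k t _)

_≟ᵛ_ : ∀ {N} → DecidableEquality (Vec Bool N)
_≟ᵛ_ = Vec.≡-dec Bool._≟_

𝔼-point : ∀ N (a : Vec Bool N) g → 𝔼 N (λ v → 𝟙 (does (v ≟ᵛ a)) * g v) ≡ ½ ^ℚ N * g a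
𝔼-point zero    []           g = refl
𝔼-point (suc N) (true  ∷ as) g = begin
  ½ * (𝔼 N (λ v → 𝟙 (does (v ≟ᵛ as)) * g (true ∷ v)) + 𝔼 N (λ v → 0ℚ * g (false ∷ v)))
    ≡⟨ cong₂ (λ p q → ½ * (p + q)) (𝔼-point N as (λ v → g (true ∷ v)))
             (trans (𝔼-cong N (λ v → *-zeroˡ (g (false ∷ v)))) (𝔼-const N 0ℚ)) ⟩
  ½ * (½ ^ℚ N * g (true ∷ as) + 0ℚ)
    ≡⟨ solve 2 (λ p q → con ½ :* (p :* q :+ con 0ℚ) := con ½ :* p :* q) refl (½ ^ℚ N) (g (true ∷ as)) ⟩
  ½ * ½ ^ℚ N * g (true ∷ as) ∎
  where open ≡-Reasoning
𝔼-point (suc N) (false ∷ as) g = begin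
  ½ * (𝔼 N (λ v → 0ℚ * g (true ∷ v)) + 𝔼 N (λ v → 𝟙 (does (v ≟ᵛ as)) * g (false ∷ v)))
    ≡⟨ cong₂ (λ p q → ½ * (p + q))
             (trans (𝔼-cong N (λ v → *-zeroˡ (g (true ∷ v)))) (𝔼-const N 0ℚ))
             (𝔼-point N as (λ v → g (false ∷ v))) ⟩
  ½ * (0ℚ + ½ ^ℚ N * g (false ∷ as))
    ≡⟨ solve 2 (λ p q → con ½ :* (con 0ℚ :+ p :* q) := con ½ :* p :* q) refl (½ ^ℚ N) (g (false ∷ as)) ⟩
  ½ * ½ ^ℚ N * g (false ∷ as) ∎
  where open ≡-Reasoning

𝔼-∏ : ∀ N (f : Fin N → Bool → ℚ) → 𝔼 N (λ v → ∏ N (λ j → f j (lookup v j))) ≡ ∏ N (avg ∘ f)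
𝔼-∏ zero    f = refl
𝔼-∏ (suc N) f = begin
  avg (λ c → 𝔼 N (λ v → f zero c * ∏ N (λ j → f (suc j) (lookup v j))))
    ≡⟨ cong₂ (λ a b → ½ * (a + b)) (𝔼-*ˡ N (f zero true) _) (𝔼-*ˡ N (f zero false) _) ⟩
  avg (λ c → f zero c * 𝔼 N (λ v → ∏ N (λ j → f (suc j) (lookup v j))))
    ≡⟨ cong (λ p → avg (λ c → f zero c * p)) (𝔼-∏ N (f ∘ suc)) ⟩
  avg (λ c → f zero c * ∏ N (avg ∘ f ∘ suc))
    ≡⟨ avg-*ʳ (f zero) _ ⟩
  ∏ (suc N) (avg ∘ f) ∎
  where open ≡-Reasoning

𝟙-tabulate-≟ : ∀ N (g : Fin N → Bool) a →
  𝟙 (does (tabulate g ≟ᵛ a)) ≡ ∏ N (λ j → 𝟙 (does (g j Bool.≟ lookup a j)))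
𝟙-tabulate-≟ zero    g []       = refl
𝟙-tabulate-≟ (suc N) g (a ∷ as) =
  trans (𝟙-∧ (does (g zero Bool.≟ a)) _)
        (cong (𝟙 (does (g zero Bool.≟ a)) *_) (𝟙-tabulate-≟ N (g ∘ suc) as))

𝔼× : ∀ {N M} → (Vec Bool N × Vec Bool M → ℚ) → ℚ
𝔼× {N} {M} f = 𝔼 N (λ x → 𝔼 M (λ y → f (x , y)))

module _ {N M : ℕ} where

  𝔼×-cong : {f g : Vec Bool N × Vec Bool M → ℚ} → (∀ ω → f ω ≡ g ω) → 𝔼× f ≡ 𝔼× g
  𝔼×-cong f≗g = 𝔼-cong N (λ x → 𝔼-cong M (λ y → f≗g (x , y)))

  𝔼×-mono : {f g : Vec Bool N × Vec Bool M → ℚ} → (∀ ω → f ω ≤ g ω) → 𝔼× f ≤ 𝔼× g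
  𝔼×-mono f≤g = 𝔼-mono N (λ x → 𝔼-mono M (λ y → f≤g (x , y)))

  𝔼×-nonNeg : {f : Vec Bool N × Vec Bool M → ℚ} → (∀ ω → 0ℚ ≤ f ω) → 0ℚ ≤ 𝔼× f
  𝔼×-nonNeg f≥0 = 𝔼-nonNeg N (λ x → 𝔼-nonNeg M (λ y → f≥0 (x , y)))

  𝔼×-+ : ∀ f g → 𝔼× {N} {M} (λ ω → f ω + g ω) ≡ 𝔼× f + 𝔼× g
  𝔼×-+ f g = trans (𝔼-cong N (λ x → 𝔼-+ M _ _)) (𝔼-+ N _ _)

  𝔼×-*ˡ : ∀ k f → 𝔼× {N} {M} (λ ω → k * f ω) ≡ k * 𝔼× f
  𝔼×-*ˡ k f = trans (𝔼-cong N (λ x → 𝔼-*ˡ M k _)) (𝔼-*ˡ N k _)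

  𝔼×-const : ∀ q → 𝔼× {N} {M} (λ _ → q) ≡ q
  𝔼×-const q = trans (𝔼-cong N (λ x → 𝔼-const M q)) (𝔼-const N q)

  𝔼×-comm : ∀ K (f : Vec Bool K → Vec Bool N × Vec Bool M → ℚ) →
    𝔼× (λ ω → 𝔼 K (λ t → f t ω)) ≡ 𝔼 K (λ t → 𝔼× (f t))
  𝔼×-comm K f = trans (𝔼-cong N (λ x → 𝔼-comm M K (λ y t → f t (x , y))))
                      (𝔼-comm N K (λ x t → 𝔼 M (λ y → f t (x , y))))

_≟ᴬ_ : ∀ {N M} → DecidableEquality (Vec Bool N × Vec Bool M)
(x , y) ≟ᴬ (x′ , y′) = map′ (uncurry (cong₂ _,_)) ,-injective (x ≟ᵛ x′ ×-dec y ≟ᵛ y′)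

module _ {A : Set} (_≟_ : DecidableEquality A) where

  occurrences : List A → A → ℚ
  occurrences []       a = 0ℚ
  occurrences (x ∷ xs) a = 𝟙 (does (a ≟ x)) + occurrences xs a

  occurrences-∉ : ∀ {a} xs → a ∉ xs → occurrences xs a ≡ 0ℚ
  occurrences-∉     []       a∉ = refl
  occurrences-∉ {a} (x ∷ xs) a∉ with a ≟ x
  ... | yes a≡x = contradiction (here a≡x) a∉
  ... | no  _   = trans (+-identityˡ _) (occurrences-∉ xs (a∉ ∘ there))

  occurrences≤1 : ∀ {a xs} → Unique xs → occurrences xs a ≤ 1ℚ
  occurrences≤1         {xs = []}     []            = ≤ᵇ⇒≤ tt
  occurrences≤1 {a} {xs = x ∷ xs} (x∉xs ∷ unique) with a ≟ x
  ... | yes refl =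
    ≤-reflexive (cong (λ q → 1ℚ + q) (occurrences-∉ xs (λ a∈xs → All.lookup x∉xs a∈xs refl)))
  ... | no  _    = subst (_≤ 1ℚ) (sym (+-identityˡ _)) (occurrences≤1 unique)

  occurrences≤𝟙 : ∀ {a xs b} → Unique xs → (a ∈ xs → T b) → occurrences xs a ≤ 𝟙 b
  occurrences≤𝟙 {b = true}  unique _    = occurrences≤1 unique
  occurrences≤𝟙 {b = false} unique a∉xs = ≤-reflexive (occurrences-∉ _ a∉xs)

edgeValue : Bool → Bool → Bool → Bool
edgeValue u v c = if u ∨ v then c else true

forceEdges : (G : Graph) → Vec Bool (n G) → Vec Bool (m G) → Vec Bool (m G)
forceEdges G x b = tabulate (λ e → edgeValue (lookup x (end₁ G e)) (lookup x (end₂ G e)) (lookup b e))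

draw : (G : Graph) → Assignment G → Assignment G
draw G (x , b) = x , forceEdges G x b

avg-edgeValue : ∀ u v c₀ → T (u ∨ c₀ ∨ v) →
  avg (λ c → 𝟙 (does (edgeValue u v c Bool.≟ c₀))) ≡ (if u ∨ v then ½ else 1ℚ)
avg-edgeValue true  v     true  _ = refl
avg-edgeValue true  v     false _ = refl
avg-edgeValue false true  true  _ = refl
avg-edgeValue false true  false _ = refl
avg-edgeValue false false true  _ = refl

𝔼-forceEdges≡½^numFree : ∀ G x₀ b₀ → Satisfies G (x₀ , b₀) →
  𝔼 (m G) (λ b → 𝟙 (does (forceEdges G x₀ b ≟ᵛ b₀))) ≡ ½ ^ℚ numFree G (x₀ , b₀)
𝔼-forceEdges≡½^numFree G x₀ b₀ sat = begin
  𝔼 (m G) (λ b → 𝟙 (does (forceEdges G x₀ b ≟ᵛ b₀)))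
    ≡⟨ 𝔼-cong (m G) (λ b → 𝟙-tabulate-≟ (m G) (λ e → edgeValue (u e) (v e) (lookup b e)) b₀) ⟩
  𝔼 (m G) (λ b → ∏ (m G) (λ e → coordinateFactor e (lookup b e)))
    ≡⟨ 𝔼-∏ (m G) coordinateFactor ⟩
  ∏ (m G) (λ e → avg (coordinateFactor e))
    ≡⟨ ∏-cong (m G) (λ e → avg-edgeValue (u e) (v e) (lookup b₀ e) (sat e)) ⟩
  ∏ (m G) (λ e → if isFree G (x₀ , b₀) e then ½ else 1ℚ)
    ≡⟨ sym (½^length-filter (m G) (λ e → e) (isFree G (x₀ , b₀))) ⟩
  ½ ^ℚ numFree G (x₀ , b₀) ∎
  where
  open ≡-Reasoning
  u v : Fin (m G) → Bool
  u e = lookup x₀ (end₁ G e)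
  v e = lookup x₀ (end₂ G e)
  coordinateFactor : Fin (m G) → Bool → ℚ
  coordinateFactor e c = 𝟙 (does (edgeValue (u e) (v e) c Bool.≟ lookup b₀ e))

𝔼-draw≡PrAssignment : ∀ G S → Satisfies G S → 𝔼× (λ ω → 𝟙 (does (draw G ω ≟ᴬ S))) ≡ PrAssignment G S
𝔼-draw≡PrAssignment G S@(x₀ , b₀) sat = begin
  𝔼 (n G) (λ x → 𝔼 (m G) (λ b → 𝟙 (does (x ≟ᵛ x₀) ∧ does (forceEdges G x b ≟ᵛ b₀))))
    ≡⟨ 𝔼-cong (n G) (λ x → trans (𝔼-cong (m G) (λ b → 𝟙-∧ (does (x ≟ᵛ x₀)) _))
                                    (𝔼-*ˡ (m G) (𝟙 (does (x ≟ᵛ x₀))) (edgeFactor x))) ⟩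
  𝔼 (n G) (λ x → 𝟙 (does (x ≟ᵛ x₀)) * 𝔼 (m G) (edgeFactor x))
    ≡⟨ 𝔼-point (n G) x₀ (λ x → 𝔼 (m G) (edgeFactor x)) ⟩
  ½ ^ℚ n G * 𝔼 (m G) (edgeFactor x₀)
    ≡⟨ cong (½ ^ℚ n G *_) (𝔼-forceEdges≡½^numFree G x₀ b₀ sat) ⟩
  ½ ^ℚ n G * ½ ^ℚ numFree G S
    ≡⟨ sym (^ℚ-distribˡ-+-* ½ (n G) (numFree G S)) ⟩
  PrAssignment G S ∎
  where
  open ≡-Reasoning
  edgeFactor : Vec Bool (n G) → Vec Bool (m G) → ℚ
  edgeFactor x b = 𝟙 (does (forceEdges G x b ≟ᵛ b₀))

Pr≡𝔼-occurrences : ∀ G 𝐒 → All (Satisfies G) 𝐒 → Pr G 𝐒 ≡ 𝔼× (occurrences _≟ᴬ_ 𝐒 ∘ draw G)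
Pr≡𝔼-occurrences G []      []         = sym (𝔼×-const {n G} {m G} 0ℚ)
Pr≡𝔼-occurrences G (S ∷ 𝐒) (sat ∷ 𝐒-sat) =
  trans (cong₂ _+_ (sym (𝔼-draw≡PrAssignment G S sat)) (Pr≡𝔼-occurrences G 𝐒 𝐒-sat))
        (sym (𝔼×-+ (λ ω → 𝟙 (does (draw G ω ≟ᴬ S))) (occurrences _≟ᴬ_ 𝐒 ∘ draw G)))

Subclause : Set
Subclause = Bool × Bool × Bool

meetsᵇ : Subclause → Bool → Bool → Bool → Bool
meetsᵇ (bu , be , bv) u c v = (bu ∧ u) ∨ (be ∧ c) ∨ (bv ∧ v)

localView : (G : Graph) → Fin (m G) → Assignment G → Vec Bool 3
localView G e (x , b) = lookup x (end₁ G e) ∷ lookup x (end₂ G e) ∷ lookup b e ∷ []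

localMeets : Subclause → Vec Bool 3 → Bool
localMeets C (u ∷ v ∷ c ∷ []) = meetsᵇ C u (edgeValue u v c) v

meets⇒localMeets : ∀ G e C ω → MeetsSub G e C (draw G ω) → T (localMeets C (localView G e ω))
meets⇒localMeets G e C (x , b) = subst (λ c → T (meetsᵇ C _ c _)) (lookup∘tabulate _ e)

-- Making the omitted literal true and the two others false misses C; when the edge literal is
-- the omitted one, u = v = false forces the edge to true.
𝔼-localMeets≤7/8 : ∀ C → ProperSub C → 𝔼 3 (𝟙 ∘ localMeets C) ≤ + 7 / 8
𝔼-localMeets≤7/8 (true  , true  , true ) proper = contradiction tt proper
𝔼-localMeets≤7/8 (true  , true  , false) _      = ≤ᵇ⇒≤ tt
𝔼-localMeets≤7/8 (true  , false , true ) _      = ≤ᵇ⇒≤ tt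
𝔼-localMeets≤7/8 (true  , false , false) _      = ≤ᵇ⇒≤ tt
𝔼-localMeets≤7/8 (false , true  , true ) _      = ≤ᵇ⇒≤ tt
𝔼-localMeets≤7/8 (false , true  , false) _      = ≤ᵇ⇒≤ tt
𝔼-localMeets≤7/8 (false , false , true ) _      = ≤ᵇ⇒≤ tt
𝔼-localMeets≤7/8 (false , false , false) _      = ≤ᵇ⇒≤ tt

Disjoint : (G : Graph) → Fin (m G) → Fin (m G) → Set
Disjoint G e e′ = ∀ v → Incident G v e → Incident G v e′ → ⊥

disjoint⇒distinct : ∀ {G e e′ v w} → Disjoint G e e′ → Incident G v e → Incident G w e′ → w ≢ v
disjoint⇒distinct disjoint v∼e v∼e′ refl = disjoint _ v∼e v∼e′

flipEdge : (G : Graph) → Fin (m G) → Vec Bool 3 → Assignment G → Assignment G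
flipEdge G e (t₁ ∷ t₂ ∷ t₃ ∷ []) (x , b) = flipAt (end₁ G e) t₁ (flipAt (end₂ G e) t₂ x) , flipAt e t₃ b

𝔼×-flipEdge : ∀ G e t (f : Assignment G → ℚ) → 𝔼× (f ∘ flipEdge G e t) ≡ 𝔼× f
𝔼×-flipEdge G e (t₁ ∷ t₂ ∷ t₃ ∷ []) f = begin
  𝔼 (n G) (λ x → 𝔼 (m G) (λ b → f (flipAt (end₁ G e) t₁ (flipAt (end₂ G e) t₂ x) , flipAt e t₃ b)))
    ≡⟨ 𝔼-cong (n G) (λ x → 𝔼-flipAt (m G) e t₃ _) ⟩
  𝔼 (n G) (λ x → g (flipAt (end₁ G e) t₁ (flipAt (end₂ G e) t₂ x)))
    ≡⟨ 𝔼-flipAt (n G) (end₂ G e) t₂ (g ∘ flipAt (end₁ G e) t₁) ⟩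
  𝔼 (n G) (λ x → g (flipAt (end₁ G e) t₁ x))
    ≡⟨ 𝔼-flipAt (n G) (end₁ G e) t₁ g ⟩
  𝔼 (n G) g ∎
  where
  open ≡-Reasoning
  g : Vec Bool (n G) → ℚ
  g x = 𝔼 (m G) (λ b → f (x , b))

localView-flipEdge : ∀ G e t ω → localView G e (flipEdge G e t ω) ≡ t ⊕ localView G e ω
localView-flipEdge G e (t₁ ∷ t₂ ∷ t₃ ∷ []) (x , b) =
  cong₂ _∷_ (trans (lookup∘updateAt (end₁ G e) (flipAt (end₂ G e) t₂ x))
                   (cong (t₁ xor_) (lookup∘updateAt′ (end₁ G e) (end₂ G e) (loopless G e) x)))
  (cong₂ _∷_ (trans (lookup∘updateAt′ (end₂ G e) (end₁ G e) (loopless G e ∘ sym)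
                                      (flipAt (end₂ G e) t₂ x))
                    (lookup∘updateAt (end₂ G e) x))
  (cong (_∷ []) (lookup∘updateAt e b)))

localView-flipEdge-disjoint : ∀ G {e e′} t ω → Disjoint G e e′ →
  localView G e′ (flipEdge G e t ω) ≡ localView G e′ ω
localView-flipEdge-disjoint G {e} {e′} (t₁ ∷ t₂ ∷ t₃ ∷ []) (x , b) disjoint =
  cong₂ _∷_ (untouched (inj₁ refl)) (cong₂ _∷_ (untouched (inj₂ refl))
    (cong (_∷ []) (lookup∘updateAt′ e′ e e′≢e b)))
  where
  untouched : ∀ {w} → Incident G w e′ →
    lookup (flipAt (end₁ G e) t₁ (flipAt (end₂ G e) t₂ x)) w ≡ lookup x w
  untouched {w} w∼e′ =
    trans (lookup∘updateAt′ w (end₁ G e) (disjoint⇒distinct {G} disjoint (inj₁ refl) w∼e′)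
                            (flipAt (end₂ G e) t₂ x))
          (lookup∘updateAt′ w (end₂ G e) (disjoint⇒distinct {G} disjoint (inj₂ refl) w∼e′) x)
  e′≢e : e′ ≢ e
  e′≢e refl = disjoint (end₁ G e) (inj₁ refl) (inj₁ refl)

𝔼×-localView-independent : ∀ G e (h : Vec Bool 3 → ℚ) (P : Assignment G → ℚ) →
  (∀ t ω → P (flipEdge G e t ω) ≡ P ω) →
  𝔼× (λ ω → h (localView G e ω) * P ω) ≡ 𝔼 3 h * 𝔼× P
𝔼×-localView-independent G e h P P-invariant = begin
  𝔼× (λ ω → h (view ω) * P ω)
    ≡⟨ sym (𝔼-const 3 _) ⟩
  𝔼 3 (λ t → 𝔼× (λ ω → h (view ω) * P ω))
    ≡⟨ 𝔼-cong 3 (λ t → sym (𝔼×-flipEdge G e t (λ ω → h (view ω) * P ω))) ⟩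
  𝔼 3 (λ t → 𝔼× (λ ω → h (view (flipEdge G e t ω)) * P (flipEdge G e t ω)))
    ≡⟨ 𝔼-cong 3 (λ t → 𝔼×-cong (λ ω →
         cong₂ _*_ (cong h (localView-flipEdge G e t ω)) (P-invariant t ω))) ⟩
  𝔼 3 (λ t → 𝔼× (λ ω → h (t ⊕ view ω) * P ω))
    ≡⟨ sym (𝔼×-comm 3 (λ t ω → h (t ⊕ view ω) * P ω)) ⟩
  𝔼× (λ ω → 𝔼 3 (λ t → h (t ⊕ view ω) * P ω))
    ≡⟨ 𝔼×-cong (λ ω → trans (𝔼-*ʳ 3 (λ t → h (t ⊕ view ω)) (P ω))
                            (cong (_* P ω) (𝔼-⊕ 3 (view ω) h))) ⟩
  𝔼× (λ ω → 𝔼 3 h * P ω)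
    ≡⟨ 𝔼×-*ˡ (𝔼 3 h) P ⟩
  𝔼 3 h * 𝔼× P ∎
  where
  open ≡-Reasoning
  view : Assignment G → Vec Bool 3
  view = localView G e

Subclauses : (G : Graph) → List (Fin (m G)) → Set
Subclauses G M = ∀ {e} → e ∈ M → Subclause

meetsAll : (G : Graph) (M : List (Fin (m G))) → Subclauses G M → Assignment G → Bool
meetsAll G []      C ω = true
meetsAll G (e ∷ M) C ω =
  localMeets (C (here refl)) (localView G e ω) ∧ meetsAll G M (λ p → C (there p)) ω

meetsAll-flipEdge : ∀ G {e} M (C : Subclauses G M) t ω → All (Disjoint G e) M →
  meetsAll G M C (flipEdge G e t ω) ≡ meetsAll G M C ω
meetsAll-flipEdge G []       C t ω []                    = refl
meetsAll-flipEdge G (e′ ∷ M) C t ω (disjoint ∷ disjoints) =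
  cong₂ _∧_ (cong (localMeets (C (here refl))) (localView-flipEdge-disjoint G t ω disjoint))
            (meetsAll-flipEdge G M (λ p → C (there p)) t ω disjoints)

meetsAll-complete : ∀ G M (C : Subclauses G M) ω →
  (∀ {e} (p : e ∈ M) → MeetsSub G e (C p) (draw G ω)) → T (meetsAll G M C ω)
meetsAll-complete G []      C ω meets = tt
meetsAll-complete G (e ∷ M) C ω meets = Equivalence.from T-∧
  (meets⇒localMeets G e (C (here refl)) ω (meets (here refl)) ,
   meetsAll-complete G M (λ p → C (there p)) ω (λ p → meets (there p)))

𝔼×-meetsAll≤ : ∀ G M (C : Subclauses G M) → AllPairs (Disjoint G) M →
  (∀ {e} (p : e ∈ M) → ProperSub (C p)) → 𝔼× (𝟙 ∘ meetsAll G M C) ≤ (+ 7 / 8) ^ℚ length M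
𝔼×-meetsAll≤ G []      C []                      proper = ≤-reflexive (𝔼×-const {n G} {m G} 1ℚ)
𝔼×-meetsAll≤ G (e ∷ M) C (disjoints ∷ pairwise) proper = begin
  𝔼× (𝟙 ∘ meetsAll G (e ∷ M) C)
    ≡⟨ 𝔼×-cong (λ ω → 𝟙-∧ (localMeets C₀ (localView G e ω)) _) ⟩
  𝔼× (λ ω → 𝟙 (localMeets C₀ (localView G e ω)) * rest ω)
    ≡⟨ 𝔼×-localView-independent G e (𝟙 ∘ localMeets C₀) rest
         (λ t ω → cong 𝟙 (meetsAll-flipEdge G M Cs t ω disjoints)) ⟩
  𝔼 3 (𝟙 ∘ localMeets C₀) * 𝔼× rest
    ≤⟨ *-monoʳ-≤-nonNeg (𝔼× rest) {{nonNegative (𝔼×-nonNeg (𝟙-nonNeg ∘ meetsAll G M Cs))}}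
         (𝔼-localMeets≤7/8 C₀ (proper (here refl))) ⟩
  + 7 / 8 * 𝔼× rest
    ≤⟨ *-monoˡ-≤-nonNeg (+ 7 / 8) (𝔼×-meetsAll≤ G M Cs pairwise (λ p → proper (there p))) ⟩
  (+ 7 / 8) ^ℚ length (e ∷ M) ∎
  where
  open ≤-Reasoning
  C₀ : Subclause
  C₀ = C (here refl)
  Cs : Subclauses G M
  Cs p = C (there p)
  rest : Assignment G → ℚ
  rest = 𝟙 ∘ meetsAll G M Cs

matching⇒pairwiseDisjoint : ∀ G M → Unique M → IsMatching G M → AllPairs (Disjoint G) M
matching⇒pairwiseDisjoint G []      []                  matching = []
matching⇒pairwiseDisjoint G (e ∷ M) (e∉M ∷ unique) matching =
  All.tabulate (λ e′∈M → matching _ _ (here refl) (there e′∈M) (All.lookup e∉M e′∈M))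
  ∷ matching⇒pairwiseDisjoint G M unique (λ e₁ e₂ p₁ p₂ → matching e₁ e₂ (there p₁) (there p₂))

theorem8 : (G : Graph) → NoIsolatedVertices G →
    (M : List (Fin (m G))) → Unique M → IsMatching G M →
    (𝐒 : List (Assignment G)) → Unique 𝐒 → All (Satisfies G) 𝐒 →
    FixesAll G 𝐒 M →
    Pr G 𝐒 ≤ ((+ 7 / 8) ^ℚ length M)
-- The bound holds for every graph.
theorem8 G _ M M-unique matching 𝐒 𝐒-unique 𝐒-sat fixes = begin
  Pr G 𝐒
    ≡⟨ Pr≡𝔼-occurrences G 𝐒 𝐒-sat ⟩
  𝔼× (occurrences _≟ᴬ_ 𝐒 ∘ draw G)
    ≤⟨ 𝔼×-mono (λ ω → occurrences≤𝟙 _≟ᴬ_ 𝐒-unique (λ drawn∈𝐒 →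
         meetsAll-complete G M C ω (λ p → proj₂ (proj₂ (fixes _ p)) _ drawn∈𝐒))) ⟩
  𝔼× (𝟙 ∘ meetsAll G M C)
    ≤⟨ 𝔼×-meetsAll≤ G M C (matching⇒pairwiseDisjoint G M M-unique matching)
                    (λ p → proj₁ (proj₂ (fixes _ p))) ⟩
  (+ 7 / 8) ^ℚ length M ∎
  where
  open ≤-Reasoning
  C : Subclauses G M
  C p = proj₁ (fixes _ p)
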